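{- Let $T$ be an AVL tree with $n$ nodes. Let $a$ be the number of depth-0 nodes (leaves) of $T$, let $b$ be the number of depth-1 nodes, and let $b_2$ be the number of balanced depth-1 nodes. Put $\alpha=a/n$ and $\beta_2=b_2/b$. If $\alpha\leq 0.4$, then \[\beta_2\leq\frac{3\alpha-1}{1-\alpha}.\]
   Context: A binary tree is a rooted tree in which every node has at most one left child and at most one right child. The height of a tree is the number of edges on a longest path from its root to a leaf, and the empty tree has height $-1$. An AVL tree is a binary tree in which, at every node, the subtrees rooted at the left and right children (possibly empty) have heights differing by at most $1$. The depth of a node is the height of the subtree rooted at it. A node is balanced if its left and right subtrees have equal height, and unbalanced otherwise. -}

module Defs where

open import Data.Nat using (ℕ; zero; suc; _≤_) renaming (_+_ to _+ℕ_)
open import Data.Integer using (ℤ; +_; -[1+_]; _⊔_; ∣_∣; _-_) renaming (_+_ to _+ℤ_)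
import Data.Integer as ℤ
open import Data.Rational using (ℚ; 0ℚ; _÷_; ≢-nonZero)
import Data.Rational as ℚ
open import Data.Product using (_×_)
open import Data.Unit using (⊤)
open import Relation.Nullary using (yes; no)
open import Relation.Binary.PropositionalEquality using (_≡_)

data Tree : Set where
  empty : Tree
  node  : Tree → Tree → Tree

size : Tree → ℕ
size empty      = 0
size (node l r) = suc (size l +ℕ size r)

-- height; the empty tree has height -1
height : Tree → ℤ
height empty      = -[1+ 0 ]
height (node l r) = + 1 +ℤ (height l ⊔ height r)

IsAVL : Tree → Set
IsAVL empty      = ⊤
IsAVL (node l r) = (∣ height l - height r ∣ ≤ 1) × IsAVL l × IsAVL r

-- number of nodes of depth (= height of the subtree rooted there) k
countDepth : ℤ → Tree → ℕ
countDepth k empty = 0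
countDepth k (node l r) with height (node l r) ℤ.≟ k
... | yes _ = suc (countDepth k l +ℕ countDepth k r)
... | no  _ = countDepth k l +ℕ countDepth k r

countBalancedDepth : ℤ → Tree → ℕ
countBalancedDepth k empty = 0
countBalancedDepth k (node l r) with height (node l r) ℤ.≟ k | height l ℤ.≟ height r
... | yes _ | yes _ = suc (countBalancedDepth k l +ℕ countBalancedDepth k r)
... | _     | _     = countBalancedDepth k l +ℕ countBalancedDepth k r

-- total division on ℚ (x / 0 := 0); only used where the denominator is nonzero
_÷'_ : ℚ → ℚ → ℚ
p ÷' q with q ℚ.≟ 0ℚ
... | yes _   = 0ℚ
... | no q≢0  = _÷_ p q {{≢-nonZero q≢0}}

ℕ→ℚ : ℕ → ℚ
ℕ→ℚ n = (+ n) ℚ./ 1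

module Submission where

-- Count the n + 1 empty subtrees of T. In an AVL tree a node of height at least 2
-- has no empty child, so they hang from leaves (two each) and from unbalanced
-- depth-1 nodes (one each): n + 1 = 2a + (b - b₂). The children of a depth-1 node
-- are distinct leaves, two of them if it is balanced and one otherwise, so
-- b₂ + b ≤ a. Clearing denominators, the claim becomes b₂ (n - a) ≤ b (3a - n),
-- which follows from these two relations and b₂ ≤ b. The hypothesis α ≤ 2/5 is
-- only needed to make 1 - α positive.

open import Defs

module Counting where

  open import Data.Nat using (ℕ; suc; _+_; _*_; _≤_; z≤n; s≤s)
  import Data.Nat as ℕ
  open import Data.Nat.Properties
  open import Data.Nat.Solver using (module +-*-Solver)
  open import Data.Integer using (ℤ; +_; -[1+_]; _⊔_; ∣_∣; _-_)
  import Data.Integer as ℤ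
  open import Data.Bool using (true; false; if_then_else_)
  open import Data.Empty using (⊥; ⊥-elim)
  open import Data.Product using (_,_)
  open import Relation.Nullary using (yes; no; does)
  open import Relation.Binary.PropositionalEquality

  open +-*-Solver

  𝟙[_≡_] : ℤ → ℤ → ℕ
  𝟙[ x ≡ y ] = if does (x ℤ.≟ y) then 1 else 0

  𝟙≤1 : ∀ x y → 𝟙[ x ≡ y ] ≤ 1
  𝟙≤1 x y with does (x ℤ.≟ y)
  ... | true  = s≤s z≤n
  ... | false = z≤n

  countDepth-node : ∀ k l r →
    countDepth k (node l r) ≡ 𝟙[ height (node l r) ≡ k ] + (countDepth k l + countDepth k r)
  countDepth-node k l r with height (node l r) ℤ.≟ k
  ... | yes _ = refl
  ... | no  _ = refl

  countBalancedDepth-node : ∀ k l r →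
    countBalancedDepth k (node l r) ≡
      𝟙[ height (node l r) ≡ k ] * 𝟙[ height l ≡ height r ] + (countBalancedDepth k l + countBalancedDepth k r)
  countBalancedDepth-node k l r with height (node l r) ℤ.≟ k | height l ℤ.≟ height r
  ... | yes _ | yes _ = refl
  ... | yes _ | no  _ = refl
  ... | no  _ | yes _ = refl
  ... | no  _ | no  _ = refl

  countBalancedDepth≤countDepth : ∀ k T → countBalancedDepth k T ≤ countDepth k T
  countBalancedDepth≤countDepth k empty = z≤n
  countBalancedDepth≤countDepth k (node l r)
    rewrite countBalancedDepth-node k l r | countDepth-node k l r =
    +-mono-≤ (≤-trans (*-monoʳ-≤ h (𝟙≤1 (height l) (height r))) (≤-reflexive (*-identityʳ h)))
             (+-mono-≤ (countBalancedDepth≤countDepth k l) (countBalancedDepth≤countDepth k r))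
    where h = 𝟙[ height (node l r) ≡ k ]

  data HeightView : ℤ → Set where
    empty-height : HeightView -[1+ 0 ]
    leaf-height  : HeightView (+ 0)
    tall-height  : ∀ m → HeightView (+ suc m)

  heightView : ∀ T → HeightView (height T)
  heightView empty      = empty-height
  heightView (node l r) = join (heightView l) (heightView r)
    where
    join : ∀ {x y} → HeightView x → HeightView y → HeightView (+ 1 ℤ.+ (x ⊔ y))
    join empty-height    empty-height    = leaf-height
    join empty-height    leaf-height     = tall-height 0
    join empty-height    (tall-height m) = tall-height (suc m)
    join leaf-height     empty-height    = tall-height 0
    join leaf-height     leaf-height     = tall-height 0
    join leaf-height     (tall-height m) = tall-height (suc m)
    join (tall-height m) empty-height    = tall-height (suc m)
    join (tall-height m) leaf-height     = tall-height (suc m)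
    join (tall-height m) (tall-height n) = tall-height (suc (m ℕ.⊔ n))

  ∣-1-[1+m]∣≰1 : ∀ m → ∣ -[1+ 0 ] - + suc m ∣ ≤ 1 → ⊥
  ∣-1-[1+m]∣≰1 m (s≤s p) with () ← ≤-trans (s≤s z≤n) p

  ∣[1+m]+1∣≰1 : ∀ m → ∣ + suc m - -[1+ 0 ] ∣ ≤ 1 → ⊥
  ∣[1+m]+1∣≰1 m (s≤s p) with () ← ≤-trans (m≤n+m 1 m) p

  private
    node-height : ℤ → ℤ → ℤ
    node-height x y = + 1 ℤ.+ (x ⊔ y)

  empty-children-local : ∀ {x y} → HeightView x → HeightView y → ∣ x - y ∣ ≤ 1 →
    𝟙[ node-height x y ≡ + 1 ] * 𝟙[ x ≡ y ] + 𝟙[ x ≡ -[1+ 0 ] ] + 𝟙[ y ≡ -[1+ 0 ] ]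
      ≡ 2 * 𝟙[ node-height x y ≡ + 0 ] + 𝟙[ node-height x y ≡ + 1 ] + 𝟙[ node-height x y ≡ -[1+ 0 ] ]
  empty-children-local empty-height    empty-height    _ = refl
  empty-children-local empty-height    leaf-height     _ = refl
  empty-children-local empty-height    (tall-height m) p = ⊥-elim (∣-1-[1+m]∣≰1 m p)
  empty-children-local leaf-height     empty-height    _ = refl
  empty-children-local leaf-height     leaf-height     _ = refl
  empty-children-local leaf-height     (tall-height m) _ = refl
  empty-children-local (tall-height m) empty-height    p = ⊥-elim (∣[1+m]+1∣≰1 m p)
  empty-children-local (tall-height m) leaf-height     _ = refl
  empty-children-local (tall-height m) (tall-height n) _ = refl

  leaf-children-local : ∀ {x y} → HeightView x → HeightView y → ∣ x - y ∣ ≤ 1 →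
    𝟙[ node-height x y ≡ + 1 ] * 𝟙[ x ≡ y ] + 𝟙[ node-height x y ≡ + 1 ] ≤ 𝟙[ x ≡ + 0 ] + 𝟙[ y ≡ + 0 ]
  leaf-children-local empty-height    empty-height    _ = z≤n
  leaf-children-local empty-height    leaf-height     _ = s≤s z≤n
  leaf-children-local empty-height    (tall-height m) p = ⊥-elim (∣-1-[1+m]∣≰1 m p)
  leaf-children-local leaf-height     empty-height    _ = s≤s z≤n
  leaf-children-local leaf-height     leaf-height     _ = s≤s (s≤s z≤n)
  leaf-children-local leaf-height     (tall-height m) _ = z≤n
  leaf-children-local (tall-height m) empty-height    p = ⊥-elim (∣[1+m]+1∣≰1 m p)
  leaf-children-local (tall-height m) leaf-height     _ = z≤n
  leaf-children-local (tall-height m) (tall-height n) _ = z≤n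

  𝟙[height-node≡-1]≡0 : ∀ l r → 𝟙[ height (node l r) ≡ -[1+ 0 ] ] ≡ 0
  𝟙[height-node≡-1]≡0 l r = nonnegative (heightView l) (heightView r)
    where
    nonnegative : ∀ {x y} → HeightView x → HeightView y → 𝟙[ node-height x y ≡ -[1+ 0 ] ] ≡ 0
    nonnegative empty-height    empty-height    = refl
    nonnegative empty-height    leaf-height     = refl
    nonnegative empty-height    (tall-height m) = refl
    nonnegative leaf-height     empty-height    = refl
    nonnegative leaf-height     leaf-height     = refl
    nonnegative leaf-height     (tall-height m) = refl
    nonnegative (tall-height m) empty-height    = refl
    nonnegative (tall-height m) leaf-height     = refl
    nonnegative (tall-height m) (tall-height n) = refl

  leaves : Tree → ℕ
  leaves = countDepth (+ 0)

  depth1 : Tree → ℕ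
  depth1 = countDepth (+ 1)

  balancedDepth1 : Tree → ℕ
  balancedDepth1 = countBalancedDepth (+ 1)

  avl-size-identity : ∀ T → IsAVL T →
    size T + 1 + balancedDepth1 T ≡ 2 * leaves T + depth1 T + 𝟙[ height T ≡ -[1+ 0 ] ]
  avl-size-identity empty      _                    = refl
  avl-size-identity (node l r) (bal , avlˡ , avlʳ)
    rewrite countDepth-node (+ 0) l r | countDepth-node (+ 1) l r | countBalancedDepth-node (+ 1) l r = begin
      suc (size l + size r) + 1 + (X + (balancedDepth1 l + balancedDepth1 r))
        ≡⟨ solve 6 (λ sl sr bl br x one → one :+ (sl :+ sr) :+ one :+ (x :+ (bl :+ br))
                                       := (sl :+ one :+ bl) :+ (sr :+ one :+ br) :+ x) refl
                   (size l) (size r) (balancedDepth1 l) (balancedDepth1 r) X 1 ⟩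
      (size l + 1 + balancedDepth1 l) + (size r + 1 + balancedDepth1 r) + X
        ≡⟨ cong₂ (λ u v → u + v + X) (avl-size-identity l avlˡ) (avl-size-identity r avlʳ) ⟩
      (2 * leaves l + depth1 l + Eˡ) + (2 * leaves r + depth1 r + Eʳ) + X
        ≡⟨ solve 7 (λ al bl el ar br er x → (con 2 :* al :+ bl :+ el) :+ (con 2 :* ar :+ br :+ er) :+ x
                                          := con 2 :* (al :+ ar) :+ (bl :+ br) :+ (x :+ el :+ er)) refl
                   (leaves l) (depth1 l) Eˡ (leaves r) (depth1 r) Eʳ X ⟩
      2 * (leaves l + leaves r) + (depth1 l + depth1 r) + (X + Eˡ + Eʳ)
        ≡⟨ cong (λ z → 2 * (leaves l + leaves r) + (depth1 l + depth1 r) + z)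
                (empty-children-local (heightView l) (heightView r) bal) ⟩
      2 * (leaves l + leaves r) + (depth1 l + depth1 r) + (2 * D0 + D1 + E)
        ≡⟨ solve 7 (λ al ar bl br d0 d1 e → con 2 :* (al :+ ar) :+ (bl :+ br) :+ (con 2 :* d0 :+ d1 :+ e)
                                          := con 2 :* (d0 :+ (al :+ ar)) :+ (d1 :+ (bl :+ br)) :+ e) refl
                   (leaves l) (leaves r) (depth1 l) (depth1 r) D0 D1 E ⟩
      2 * (D0 + (leaves l + leaves r)) + (D1 + (depth1 l + depth1 r)) + E ∎
    where
    open ≡-Reasoning
    h  = height (node l r)
    D0 = 𝟙[ h ≡ + 0 ]
    D1 = 𝟙[ h ≡ + 1 ]
    E  = 𝟙[ h ≡ -[1+ 0 ] ]
    X  = D1 * 𝟙[ height l ≡ height r ]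
    Eˡ = 𝟙[ height l ≡ -[1+ 0 ] ]
    Eʳ = 𝟙[ height r ≡ -[1+ 0 ] ]

  avl-depth1-bound : ∀ T → IsAVL T →
    balancedDepth1 T + depth1 T + 𝟙[ height T ≡ + 0 ] ≤ leaves T
  avl-depth1-bound empty      _                    = z≤n
  avl-depth1-bound (node l r) (bal , avlˡ , avlʳ)
    rewrite countDepth-node (+ 0) l r | countDepth-node (+ 1) l r | countBalancedDepth-node (+ 1) l r = begin
      (X + (balancedDepth1 l + balancedDepth1 r)) + (D1 + (depth1 l + depth1 r)) + D0
        ≡⟨ solve 7 (λ x d1 d0 bl br cl cr → (x :+ (bl :+ br)) :+ (d1 :+ (cl :+ cr)) :+ d0
                                          := d0 :+ ((x :+ d1) :+ (bl :+ cl) :+ (br :+ cr))) refl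
                   X D1 D0 (balancedDepth1 l) (balancedDepth1 r) (depth1 l) (depth1 r) ⟩
      D0 + ((X + D1) + (balancedDepth1 l + depth1 l) + (balancedDepth1 r + depth1 r))
        ≤⟨ +-monoʳ-≤ D0 (+-monoˡ-≤ _ (+-monoˡ-≤ _ (leaf-children-local (heightView l) (heightView r) bal))) ⟩
      D0 + ((Lˡ + Lʳ) + (balancedDepth1 l + depth1 l) + (balancedDepth1 r + depth1 r))
        ≡⟨ cong (λ z → D0 + z) (solve 6 (λ ll lr bl cl br cr → (ll :+ lr) :+ (bl :+ cl) :+ (br :+ cr)
                                                     := (bl :+ cl :+ ll) :+ (br :+ cr :+ lr)) refl
                                  Lˡ Lʳ (balancedDepth1 l) (depth1 l) (balancedDepth1 r) (depth1 r)) ⟩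
      D0 + ((balancedDepth1 l + depth1 l + Lˡ) + (balancedDepth1 r + depth1 r + Lʳ))
        ≤⟨ +-monoʳ-≤ D0 (+-mono-≤ (avl-depth1-bound l avlˡ) (avl-depth1-bound r avlʳ)) ⟩
      D0 + (leaves l + leaves r) ∎
    where
    open ≤-Reasoning
    h  = height (node l r)
    D0 = 𝟙[ h ≡ + 0 ]
    D1 = 𝟙[ h ≡ + 1 ]
    X  = D1 * 𝟙[ height l ≡ height r ]
    Lˡ = 𝟙[ height l ≡ + 0 ]
    Lʳ = 𝟙[ height r ≡ + 0 ]

  size≤3*leaves : ∀ n a b b₂ → n + 1 + b₂ ≡ 2 * a + b → b ≤ a → n ≤ 3 * a
  size≤3*leaves n a b b₂ e b≤a = begin
    n               ≤⟨ m≤m+n n (1 + b₂) ⟩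
    n + (1 + b₂)    ≡⟨ sym (+-assoc n 1 b₂) ⟩
    n + 1 + b₂      ≡⟨ e ⟩
    2 * a + b       ≤⟨ +-monoʳ-≤ (2 * a) b≤a ⟩
    2 * a + a       ≡⟨ solve 1 (λ a → con 2 :* a :+ a := con 3 :* a) refl a ⟩
    3 * a           ∎
    where open ≤-Reasoning

  cross-multiplied-bound : ∀ n a b b₂ → n + 1 + b₂ ≡ 2 * a + b → b₂ + b ≤ a → b₂ ≤ b →
    (b₂ + b) * n ≤ 3 * a * b + b₂ * a
  cross-multiplied-bound n a b b₂ e b₂+b≤a b₂≤b
    with c , refl ← m≤n⇒∃[o]m+o≡n b₂≤b
    with k , refl ← m≤n⇒∃[o]m+o≡n b₂+b≤a = begin
      (b₂ + b) * n                                 ≤⟨ *-monoʳ-≤ (b₂ + b) (m≤m+n n 1) ⟩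
      (b₂ + b) * (n + 1)                           ≡⟨ cong ((b₂ + b) *_) n+1≡ ⟩
      (b₂ + b) * (4 * b₂ + 3 * c + 2 * k)          ≤⟨ m≤m+n _ (c * k) ⟩
      (b₂ + b) * (4 * b₂ + 3 * c + 2 * k) + c * k  ≡⟨ solve 3 (λ b₂ c k →
          (b₂ :+ (b₂ :+ c)) :* (con 4 :* b₂ :+ con 3 :* c :+ con 2 :* k) :+ c :* k
            := con 3 :* (b₂ :+ (b₂ :+ c) :+ k) :* (b₂ :+ c) :+ b₂ :* (b₂ :+ (b₂ :+ c) :+ k)) refl b₂ c k ⟩
      3 * a * b + b₂ * a                           ∎
    where
    open ≤-Reasoning
    n+1≡ : n + 1 ≡ 4 * b₂ + 3 * c + 2 * k
    n+1≡ = +-cancelʳ-≡ b₂ (n + 1) _ (trans e (solve 3 (λ b₂ c k →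
             con 2 :* (b₂ :+ (b₂ :+ c) :+ k) :+ (b₂ :+ c) := (con 4 :* b₂ :+ con 3 :* c :+ con 2 :* k) :+ b₂) refl b₂ c k))

module Ratios where

  open import Data.Nat using (ℕ; zero; suc; NonZero)
  import Data.Nat as ℕ
  import Data.Nat.Coprimality as Coprimality
  open import Data.Integer using (+_)
  import Data.Integer as ℤ
  import Data.Integer.Properties as ℤ
  open import Data.Rational using (ℚ; mkℚ; 0ℚ; 1ℚ; _≤_; _<_; _+_; _*_; _-_; -_; _/_; 1/_; *≤*; *<*; ≢-nonZero; positive)
  import Data.Rational as ℚ
  open import Data.Rational.Properties
  open import Data.Rational.Solver using (module +-*-Solver)
  open import Data.Empty using (⊥-elim)
  open import Relation.Nullary using (yes; no)
  open import Relation.Nullary.Decidable using (toWitness)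
  open import Relation.Binary.PropositionalEquality

  open +-*-Solver

  ÷'-*-cancel : ∀ p {q} → q ≢ 0ℚ → p ÷' q * q ≡ p
  ÷'-*-cancel p {q} q≢0 with q ℚ.≟ 0ℚ
  ... | yes q≡0 = ⊥-elim (q≢0 q≡0)
  ... | no  _   = begin
    p * 1/ q * q    ≡⟨ *-assoc p (1/ q) q ⟩
    p * (1/ q * q)  ≡⟨ cong (p *_) (*-inverseˡ q) ⟩
    p * 1ℚ          ≡⟨ *-identityʳ p ⟩
    p               ∎
    where
    open ≡-Reasoning
    instance _ = ≢-nonZero q≢0

  *≤⇒≤÷' : ∀ {p q r} → 0ℚ < q → p * q ≤ r → p ≤ r ÷' q
  *≤⇒≤÷' {p} {q} {r} 0<q pq≤r = *-cancelʳ-≤-pos q (begin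
    p * q           ≤⟨ pq≤r ⟩
    r               ≡⟨ ÷'-*-cancel r (≢-sym (<⇒≢ 0<q)) ⟨
    r ÷' q * q      ∎)
    where
    open ≤-Reasoning
    instance _ = positive 0<q

  ℕ→ℚ≡mkℚ : ∀ n → ℕ→ℚ n ≡ mkℚ (+ n) 0 (Coprimality.sym (Coprimality.1-coprimeTo n))
  ℕ→ℚ≡mkℚ n = ↥p/↧p≡p _

  ℕ→ℚ-homo-+ : ∀ m n → ℕ→ℚ (m ℕ.+ n) ≡ ℕ→ℚ m + ℕ→ℚ n
  ℕ→ℚ-homo-+ m n rewrite ℕ→ℚ≡mkℚ m | ℕ→ℚ≡mkℚ n =
    cong (_/ 1) (trans (ℤ.pos-+ m n) (sym (cong₂ ℤ._+_ (ℤ.*-identityʳ (+ m)) (ℤ.*-identityʳ (+ n)))))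

  ℕ→ℚ-homo-* : ∀ m n → ℕ→ℚ (m ℕ.* n) ≡ ℕ→ℚ m * ℕ→ℚ n
  ℕ→ℚ-homo-* m n rewrite ℕ→ℚ≡mkℚ m | ℕ→ℚ≡mkℚ n = cong (_/ 1) (ℤ.pos-* m n)

  ℕ→ℚ-mono-≤ : ∀ {m n} → m ℕ.≤ n → ℕ→ℚ m ≤ ℕ→ℚ n
  ℕ→ℚ-mono-≤ {m} {n} m≤n rewrite ℕ→ℚ≡mkℚ m | ℕ→ℚ≡mkℚ n =
    *≤* (subst₂ ℤ._≤_ (sym (ℤ.*-identityʳ (+ m))) (sym (ℤ.*-identityʳ (+ n))) (ℤ.+≤+ m≤n))

  ℕ→ℚ-pos : ∀ n .{{_ : NonZero n}} → 0ℚ < ℕ→ℚ n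
  ℕ→ℚ-pos (suc n) rewrite ℕ→ℚ≡mkℚ (suc n) = *<* (ℤ.+<+ (ℕ.s≤s ℕ.z≤n))

  ÷'-ℕ→ℚ-*-cancel : ∀ p n .{{_ : NonZero n}} → p ÷' ℕ→ℚ n * ℕ→ℚ n ≡ p
  ÷'-ℕ→ℚ-*-cancel p n = ÷'-*-cancel p (≢-sym (<⇒≢ (ℕ→ℚ-pos n)))

  private
    3ℚ : ℚ
    3ℚ = + 3 / 1

  three-α-1-nonneg : ∀ {α A N} → α * N ≡ A → 0ℚ < N → N ≤ 3ℚ * A → 0ℚ ≤ 3ℚ * α - 1ℚ
  three-α-1-nonneg {α} {N = N} refl 0<N N≤3A = *-cancelʳ-≤-pos N (begin
    0ℚ * N                  ≡⟨ *-zeroˡ N ⟩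
    0ℚ                      ≡⟨ +-inverseʳ N ⟨
    N - N                   ≤⟨ +-monoˡ-≤ (- N) N≤3A ⟩
    3ℚ * (α * N) - N        ≡⟨ solve 3 (λ t a n → t :* (a :* n) :- n := (t :* a :- con 1ℚ) :* n) refl 3ℚ α N ⟩
    (3ℚ * α - 1ℚ) * N       ∎)
    where
    open ≤-Reasoning
    instance _ = positive 0<N

  ratio-cross-multiplied : ∀ {α β A N B B₂} → α * N ≡ A → β * B ≡ B₂ → 0ℚ < N → 0ℚ < B →
    (B₂ + B) * N ≤ 3ℚ * A * B + B₂ * A → β * (1ℚ - α) ≤ 3ℚ * α - 1ℚ
  ratio-cross-multiplied {α} {β} {N = N} {B} refl refl 0<N 0<B cross = *-cancelʳ-≤-pos (B * N) (begin
    β * (1ℚ - α) * (B * N)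
      ≡⟨ solve 4 (λ a b n bb → b :* (con 1ℚ :- a) :* (bb :* n)
                             := (b :* bb :+ bb) :* n :+ (:- (b :* bb :* (a :* n)) :- bb :* n)) refl α β N B ⟩
    (β * B + B) * N + (- (β * B * (α * N)) - B * N)
      ≤⟨ +-monoˡ-≤ (- (β * B * (α * N)) - B * N) cross ⟩
    3ℚ * (α * N) * B + β * B * (α * N) + (- (β * B * (α * N)) - B * N)
      ≡⟨ solve 5 (λ t a b n bb → t :* (a :* n) :* bb :+ b :* bb :* (a :* n) :+ (:- (b :* bb :* (a :* n)) :- bb :* n)
                               := (t :* a :- con 1ℚ) :* (bb :* n)) refl 3ℚ α β N B ⟩
    (3ℚ * α - 1ℚ) * (B * N) ∎)
    where
    open ≤-Reasoning
    instance _ = pos*pos⇒pos B {{positive 0<B}} N {{positive 0<N}}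

  leaf-ratio-bound : ∀ n a b b₂ .{{_ : NonZero n}} →
    n ℕ.≤ 3 ℕ.* a → (b₂ ℕ.+ b) ℕ.* n ℕ.≤ 3 ℕ.* a ℕ.* b ℕ.+ b₂ ℕ.* a →
    (ℕ→ℚ b₂ ÷' ℕ→ℚ b) * (1ℚ - ℕ→ℚ a ÷' ℕ→ℚ n) ≤ 3ℚ * (ℕ→ℚ a ÷' ℕ→ℚ n) - 1ℚ
  leaf-ratio-bound n a zero b₂ n≤3a _ =
    subst (_≤ 3ℚ * α - 1ℚ) (sym (*-zeroˡ (1ℚ - α)))
      (three-α-1-nonneg {α = α} (÷'-ℕ→ℚ-*-cancel (ℕ→ℚ a) n) (ℕ→ℚ-pos n) N≤3A)
    where
    α = ℕ→ℚ a ÷' ℕ→ℚ n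
    N≤3A : ℕ→ℚ n ≤ 3ℚ * ℕ→ℚ a
    N≤3A = subst (ℕ→ℚ n ≤_) (ℕ→ℚ-homo-* 3 a) (ℕ→ℚ-mono-≤ n≤3a)
  leaf-ratio-bound n a b@(suc _) b₂ _ cross =
    ratio-cross-multiplied {α = ℕ→ℚ a ÷' ℕ→ℚ n} {β = ℕ→ℚ b₂ ÷' ℕ→ℚ b}
      (÷'-ℕ→ℚ-*-cancel (ℕ→ℚ a) n) (÷'-ℕ→ℚ-*-cancel (ℕ→ℚ b₂) b) (ℕ→ℚ-pos n) (ℕ→ℚ-pos b)
      (subst₂ _≤_ lhs rhs (ℕ→ℚ-mono-≤ cross))
    where
    lhs : ℕ→ℚ ((b₂ ℕ.+ b) ℕ.* n) ≡ (ℕ→ℚ b₂ + ℕ→ℚ b) * ℕ→ℚ n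
    lhs = trans (ℕ→ℚ-homo-* (b₂ ℕ.+ b) n) (cong (_* ℕ→ℚ n) (ℕ→ℚ-homo-+ b₂ b))
    rhs : ℕ→ℚ (3 ℕ.* a ℕ.* b ℕ.+ b₂ ℕ.* a) ≡ 3ℚ * ℕ→ℚ a * ℕ→ℚ b + ℕ→ℚ b₂ * ℕ→ℚ a
    rhs = trans (ℕ→ℚ-homo-+ (3 ℕ.* a ℕ.* b) (b₂ ℕ.* a))
                (cong₂ _+_ (trans (ℕ→ℚ-homo-* (3 ℕ.* a) b) (cong (_* ℕ→ℚ b) (ℕ→ℚ-homo-* 3 a)))
                           (ℕ→ℚ-homo-* b₂ a))

  ≤2/5⇒0<1-p : ∀ {p} → p ≤ + 2 / 5 → 0ℚ < 1ℚ - p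
  ≤2/5⇒0<1-p {p} p≤2/5 = begin-strict
    0ℚ      ≡⟨ +-inverseʳ p ⟨
    p - p   <⟨ +-monoˡ-< (- p) (≤-<-trans p≤2/5 (toWitness {a? = + 2 / 5 ℚ.<? 1ℚ} _)) ⟩
    1ℚ - p  ∎
    where open ≤-Reasoning

open import Data.Nat using (NonZero)
import Data.Nat as ℕ
import Data.Nat.Properties as ℕ
open import Data.Integer using (+_)
open import Data.Rational using (_≤_; _-_; _*_; _/_; 1ℚ)
open import Relation.Binary.PropositionalEquality using (_≡_; cong; trans)

open Counting
open Ratios

lemma2 : (T : Tree) → IsAVL T → NonZero (size T) →
    let n  = size T
        a  = countDepth (+ 0) T
        b  = countDepth (+ 1) T
        b₂ = countBalancedDepth (+ 1) T
        α  = ℕ→ℚ a ÷' ℕ→ℚ n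
        β₂ = ℕ→ℚ b₂ ÷' ℕ→ℚ b
    in α ≤ (+ 2 / 5) → β₂ ≤ ((+ 3 / 1) * α - 1ℚ) ÷' (1ℚ - α)
lemma2 T@(node l r) avl nonZero α≤2/5 =
  *≤⇒≤÷' (≤2/5⇒0<1-p α≤2/5)
    (leaf-ratio-bound n a b b₂ {{nonZero}} (size≤3*leaves n a b b₂ identity b≤a)
                                            (cross-multiplied-bound n a b b₂ identity b₂+b≤a b₂≤b))
  where
  n  = size T
  a  = leaves T
  b  = depth1 T
  b₂ = balancedDepth1 T
  identity : n ℕ.+ 1 ℕ.+ b₂ ≡ 2 ℕ.* a ℕ.+ b
  identity = trans (avl-size-identity T avl)
                   (trans (cong (2 ℕ.* a ℕ.+ b ℕ.+_) (𝟙[height-node≡-1]≡0 l r)) (ℕ.+-identityʳ _))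
  b₂+b≤a : b₂ ℕ.+ b ℕ.≤ a
  b₂+b≤a = ℕ.≤-trans (ℕ.m≤m+n (b₂ ℕ.+ b) _) (avl-depth1-bound T avl)
  b≤a : b ℕ.≤ a
  b≤a = ℕ.≤-trans (ℕ.m≤n+m b b₂) b₂+b≤a
  b₂≤b : b₂ ℕ.≤ b
  b₂≤b = countBalancedDepth≤countDepth (+ 1) T
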